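{- Let $C\subseteq\{0,1\}^n$ be a binary linear code with a generating matrix $G$ (a matrix over $\mathbb F_2$ whose rows span $C$) in which every column appears with the same multiplicity. Let $\sigma\ge 1$ be an integer such that for every coordinate $i\in[n]$, $C^\perp$ contains at least $\sigma$ vectors of Hamming weight $3$ whose supports contain $i$. Then \[ \dim(C) \le \frac{2}{\sqrt{\sigma}}\, n. \]
   Context: $C^\perp$ is the dual code of $C$ over $\mathbb F_2$. A code with a generating matrix in which all columns have equal multiplicity is called regular; the condition on weight-$3$ dual vectors says the code is locally testable with $3$-density $\sigma$. -}

module Defs where

open import Data.Bool using (Bool; true; false; _xor_; _∧_)
open import Data.Nat using (ℕ; zero; suc; _+_)
open import Data.Fin using (Fin) renaming (zero to fzero; suc to fsuc)
open import Data.Vec using (Vec; map; []; _∷_; zipWith; replicate; lookup; tabulate)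
open import Data.List using (List; filterᵇ; length)
open import Data.List using () renaming (allFin to allFinL)
open import Data.Vec.Properties using (≡-dec)
import Data.Bool.Properties as BoolP
open import Relation.Nullary.Decidable using (⌊_⌋)
open import Relation.Binary.PropositionalEquality using (_≡_)
open import Data.Product using (Σ; _×_)

-- Words of length n over F₂ = Bool (xor is addition, ∧ is multiplication).
Word : ℕ → Set
Word n = Vec Bool n

0w : ∀ {n} → Word n
0w = replicate _ false

_⊕_ : ∀ {n} → Word n → Word n → Word n
_⊕_ = zipWith _xor_

_·s_ : ∀ {n} → Bool → Word n → Word n
b ·s v = map (b ∧_) v

dot : ∀ {n} → Word n → Word n → Bool
dot [] [] = false
dot (x ∷ xs) (y ∷ ys) = (x ∧ y) xor dot xs ys

weight : ∀ {n} → Word n → ℕ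
weight [] = 0
weight (true ∷ xs) = suc (weight xs)
weight (false ∷ xs) = weight xs

lincomb : ∀ {d n} → (Fin d → Bool) → (Fin d → Word n) → Word n
lincomb {zero} c v = 0w
lincomb {suc d} c v = (c fzero ·s v fzero) ⊕ lincomb (λ r → c (fsuc r)) (λ r → v (fsuc r))

-- A generator matrix with k rows and n columns is a family of k rows.
-- The code C generated by G is the F₂-span of its rows.
InCode : ∀ {k n} → (Fin k → Word n) → Word n → Set
InCode G x = Σ (Fin _ → Bool) λ c → lincomb c G ≡ x

InDual : ∀ {k n} → (Fin k → Word n) → Word n → Set
InDual G y = ∀ x → InCode G x → dot x y ≡ false

LinIndep : ∀ {d n} → (Fin d → Word n) → Set
LinIndep v = ∀ c → lincomb c v ≡ 0w → ∀ r → c r ≡ false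

column : ∀ {k n} → (Fin k → Word n) → Fin n → Vec Bool k
column G j = tabulate λ r → lookup (G r) j

multiplicity : ∀ {k n} → (Fin k → Word n) → Fin n → ℕ
multiplicity {k} {n} G j =
  length (filterᵇ (λ j' → ⌊ ≡-dec BoolP._≟_ (column G j') (column G j) ⌋) (allFinL n))

Regular : ∀ {k n} → (Fin k → Word n) → Set
Regular {n = n} G = ∀ (j j' : Fin n) → multiplicity G j ≡ multiplicity G j'

-- Write the d independent codewords as the rows of a d × n matrix and let u i ∈ F₂^d be its
-- i-th column. The columns span F₂^d, and every weight-3 dual word with support {a, b, y}
-- gives u a + u b = u y. Pick a nonzero value Y = u y whose class {i ∣ u i = Y} is largest,
-- say of size F, and pass to the quotient F₂^d / ⟨Y⟩; after d such steps nothing is left.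
-- At each step every one of the σ dual triangles through y has a vertex b with u b ≠ 0 and
-- u b + Y again a value of u, and, m being the common multiplicity of the columns of the
-- generator matrix, at most m triangles through y meet a given b. Hence σ ≤ m · F · p,
-- where p counts the nonzero values α for which α + Y is a value too. The
-- quotient kills the class of Y, so the F's add up to at most n; it identifies α with α + Y,
-- so the p's add up to at most twice the number of nonzero values, and that number is at
-- most n / m because every value class contains a whole column class of the generator
-- matrix. Cauchy–Schwarz over the d steps gives d² σ ≤ n · 2n.

module Submission where

open import Algebra.Bundles using (CommutativeRing)
open import Data.Bool using (Bool; true; false; _xor_; _∧_; if_then_else_)
import Data.Bool.Properties as Bool
open import Data.Empty using (⊥-elim)
open import Data.Fin using (Fin) renaming (zero to fzero; suc to fsuc)
import Data.Fin as Fin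
import Data.Fin.Properties as Fin
open import Data.List using (allFin; filterᵇ; length)
import Data.List as List
open import Data.List.Extrema.Nat using (argmax; f[xs]≤f[argmax])
open import Data.List.Membership.Propositional.Properties using (∈-allFin)
import Data.List.Relation.Unary.All as All
open import Data.Nat using (ℕ; zero; suc; _+_; _*_; _≤_; _≤?_; z≤n; s≤s; s≤s⁻¹)
open import Data.Nat.Properties
  using ( module ≤-Reasoning; ≤-refl; ≤-reflexive; ≤-trans; ≤-antisym; ≤-total; <⇒≱; ≰⇒>; m≤m+n
        ; m≤n⇒∃[o]m+o≡n; suc-injective; +-comm; +-identityʳ; +-mono-≤; +-monoʳ-≤; *-comm
        ; *-identityˡ; *-identityʳ; *-zeroʳ; *-distribˡ-+; *-mono-≤; *-monoˡ-≤; *-monoʳ-≤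
        ; *-mono-<; *-cancelˡ-≤; +-commutativeSemigroup; +-*-semiring )
open import Data.Nat.Solver using (module +-*-Solver)
open import Data.Product using (Σ; ∃; ∃₂; _×_; _,_; proj₁; proj₂)
open import Data.Sum using (_⊎_; inj₁; inj₂; [_,_])
import Data.Sum as Sum
open import Data.Unit using (tt)
open import Data.Vec using ([]; _∷_; lookup; tabulate)
import Data.Vec.Functional as Vector
open import Data.Vec.Properties
  using ( ∷-injectiveˡ; ∷-injectiveʳ; ≡-dec; lookup-map; lookup-replicate; lookup-zipWith
        ; lookup∘tabulate; tabulate∘lookup; tabulate-cong
        ; zipWith-assoc; zipWith-comm; zipWith-identityˡ; zipWith-identityʳ )
open import Function using (_∘_)
open import Function.Definitions using (Injective)
open import Level using (Level; 0ℓ)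
open import Relation.Binary.PropositionalEquality
  using (_≡_; _≢_; refl; sym; trans; cong; cong₂; subst; subst₂; module ≡-Reasoning)
open import Relation.Nullary using (Dec; yes; no; ¬_; does; isYes; ¬?; _×-dec_; _⊎-dec_)
open import Relation.Unary using (Pred; Decidable; U)
open import Relation.Unary.Properties using (U?)

open import Algebra.Properties.Semiring.Sum +-*-semiring
  using (sum; sum-syntax; sum-cong-≗; sum-replicate-zero; ∑-comm; ∑-distrib-+; *-distribˡ-sum; *-distribʳ-sum)
open import Algebra.Properties.CommutativeSemigroup +-commutativeSemigroup
  using () renaming (interchange to +-interchange)
open import Algebra.Properties.CommutativeSemigroup
  (CommutativeRing.+-commutativeSemigroup Bool.xor-∧-commutativeRing)
  using () renaming (interchange to xor-interchange)

open import Defs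

private
  variable
    ℓ ℓ′ : Level
    d n s m : ℕ
    P Q : Set ℓ

∑-mono-≤ : {f g : Fin n → ℕ} → (∀ i → f i ≤ g i) → sum f ≤ sum g
∑-mono-≤ {zero} _ = z≤n
∑-mono-≤ {suc n} f≤g = +-mono-≤ (f≤g fzero) (∑-mono-≤ (f≤g ∘ fsuc))

∑-const : ∀ n k → ∑[ i < n ] k ≡ n * k
∑-const zero k = refl
∑-const (suc n) k = cong (k +_) (∑-const n k)

∑-product : (a : Fin n → ℕ) (b : Fin m → ℕ) → ∑[ s < n ] ∑[ t < m ] (a s * b t) ≡ sum a * sum b
∑-product a b = trans (sum-cong-≗ λ s → sym (*-distribˡ-sum (a s) b)) (sym (*-distribʳ-sum (sum b) a))

𝟙 : Dec P → ℕ
𝟙 p? = if does p? then 1 else 0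

𝟙-yes : (p? : Dec P) → P → 𝟙 p? ≡ 1
𝟙-yes (yes _) _ = refl
𝟙-yes (no ¬p) p = ⊥-elim (¬p p)

𝟙-no : (p? : Dec P) → ¬ P → 𝟙 p? ≡ 0
𝟙-no (yes p) ¬p = ⊥-elim (¬p p)
𝟙-no (no _) _ = refl

𝟙-mono : {p? : Dec P} {q? : Dec Q} → (P → Q) → 𝟙 p? ≤ 𝟙 q?
𝟙-mono {p? = no _} _ = z≤n
𝟙-mono {p? = yes _} {yes _} _ = ≤-refl
𝟙-mono {p? = yes p} {no ¬q} P⇒Q = ⊥-elim (¬q (P⇒Q p))

𝟙-cong : (p? : Dec P) (q? : Dec Q) → (P → Q) → (Q → P) → 𝟙 p? ≡ 𝟙 q?
𝟙-cong p? q? P⇒Q Q⇒P = ≤-antisym (𝟙-mono {p? = p?} {q?} P⇒Q) (𝟙-mono {p? = q?} {p?} Q⇒P)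

𝟙-× : (p? : Dec P) (q? : Dec Q) → 𝟙 (p? ×-dec q?) ≡ 𝟙 p? * 𝟙 q?
𝟙-× (yes _) q? = sym (+-identityʳ (𝟙 q?))
𝟙-× (no _) q? = refl

*-𝟙-≤ : ∀ {k l} (p? : Dec P) → (P → k ≤ l) → k * 𝟙 p? ≤ l
*-𝟙-≤ {k = k} (yes p) k≤l = ≤-trans (≤-reflexive (*-identityʳ k)) (k≤l p)
*-𝟙-≤ {k = k} (no _) _ = ≤-trans (≤-reflexive (*-zeroʳ k)) z≤n

*-𝟙-monoˡ-≤ : ∀ {k l} (p? : Dec P) → (P → k ≤ l) → k * 𝟙 p? ≤ l * 𝟙 p?
*-𝟙-monoˡ-≤ (yes p) k≤l = *-monoˡ-≤ 1 (k≤l p)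
*-𝟙-monoˡ-≤ {k = k} {l} (no _) _ = ≤-reflexive (trans (*-zeroʳ k) (sym (*-zeroʳ l)))

𝟙-+-≤ : {R : Set ℓ} {S : Set ℓ′} (p? : Dec P) (q? : Dec Q) (r? : Dec R) (s? : Dec S) →
        (P → R) → (Q → R ⊎ S) → (P → Q → S) → 𝟙 p? + 𝟙 q? ≤ 𝟙 r? + 𝟙 s?
𝟙-+-≤ (no _) (no _) _ _ _ _ _ = z≤n
𝟙-+-≤ (yes p) _ (no ¬r) _ P⇒R _ _ = ⊥-elim (¬r (P⇒R p))
𝟙-+-≤ (yes _) (no _) (yes _) _ _ _ _ = s≤s z≤n
𝟙-+-≤ (yes p) (yes q) (yes _) (no ¬s) _ _ P⇒Q⇒S = ⊥-elim (¬s (P⇒Q⇒S p q))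
𝟙-+-≤ (yes _) (yes _) (yes _) (yes _) _ _ _ = ≤-refl
𝟙-+-≤ (no _) (yes _) (yes _) _ _ _ _ = s≤s z≤n
𝟙-+-≤ (no _) (yes _) (no _) (yes _) _ _ _ = ≤-refl
𝟙-+-≤ (no _) (yes q) (no ¬r) (no ¬s) _ Q⇒R⊎S _ = ⊥-elim ([ ¬r , ¬s ] (Q⇒R⊎S q))

∑-𝟙-≟ : (x : Fin n) → ∑[ b < n ] 𝟙 (x Fin.≟ b) ≡ 1
∑-𝟙-≟ {suc n} fzero = cong suc (sum-replicate-zero n)
∑-𝟙-≟ {suc n} (fsuc x) = ∑-𝟙-≟ x

count : {P : Pred (Fin n) ℓ} → Decidable P → ℕ
count {n = n} P? = ∑[ i < n ] 𝟙 (P? i)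

count-mono : {P : Pred (Fin n) ℓ} {Q : Pred (Fin n) ℓ′} (P? : Decidable P) (Q? : Decidable Q) →
             (∀ {i} → P i → Q i) → count P? ≤ count Q?
count-mono P? Q? P⇒Q = ∑-mono-≤ λ i → 𝟙-mono {p? = P? i} {Q? i} P⇒Q

count-none : {P : Pred (Fin n) ℓ} (P? : Decidable P) → (∀ i → ¬ P i) → count P? ≡ 0
count-none {n = n} P? ¬P = trans (sum-cong-≗ λ i → 𝟙-no (P? i) (¬P i)) (sum-replicate-zero n)

count-all : {P : Pred (Fin n) ℓ} (P? : Decidable P) → (∀ i → P i) → count P? ≡ n
count-all {n = n} P? allP = trans (sum-cong-≗ λ i → 𝟙-yes (P? i) (allP i)) (trans (∑-const n 1) (*-identityʳ n))

count≤n : {P : Pred (Fin n) ℓ} (P? : Decidable P) → count P? ≤ n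
count≤n P? = ≤-trans (count-mono P? U? (λ _ → tt)) (≤-reflexive (count-all U? (λ _ → tt)))

count-≤1 : {P : Pred (Fin n) ℓ} (P? : Decidable P) → (∀ {i j} → P i → P j → i ≡ j) → count P? ≤ 1
count-≤1 {n = zero} P? unique = z≤n
count-≤1 {n = suc n} P? unique with P? fzero
... | yes p₀ = ≤-reflexive (cong suc (count-none (P? ∘ fsuc) λ i pᵢ → 0≢suc (unique p₀ pᵢ)))
  where
  0≢suc : ∀ {i : Fin n} → fzero ≢ fsuc i
  0≢suc ()
... | no _ = count-≤1 (P? ∘ fsuc) λ pᵢ pⱼ → Fin.suc-injective (unique pᵢ pⱼ)

module _ {S : Pred (Fin s) ℓ} (S? : Decidable S) (g : Fin s → Fin n) where

  fibre? : (b : Fin n) → Decidable (λ j → S j × g j ≡ b)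
  fibre? b j = S? j ×-dec (g j Fin.≟ b)

  𝟙≡∑-fibres : ∀ j → 𝟙 (S? j) ≡ ∑[ b < n ] 𝟙 (fibre? b j)
  𝟙≡∑-fibres j = begin
    𝟙 (S? j)                                  ≡⟨ *-identityʳ (𝟙 (S? j)) ⟨
    𝟙 (S? j) * 1                              ≡⟨ cong (𝟙 (S? j) *_) (∑-𝟙-≟ (g j)) ⟨
    𝟙 (S? j) * ∑[ b < n ] 𝟙 (g j Fin.≟ b)     ≡⟨ *-distribˡ-sum (𝟙 (S? j)) (λ b → 𝟙 (g j Fin.≟ b)) ⟩
    ∑[ b < n ] (𝟙 (S? j) * 𝟙 (g j Fin.≟ b))   ≡⟨ sum-cong-≗ (λ b → 𝟙-× (S? j) (g j Fin.≟ b)) ⟨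
    ∑[ b < n ] 𝟙 (fibre? b j)                 ∎
    where open ≡-Reasoning

  count-by-fibres : count S? ≡ ∑[ b < n ] count (fibre? b)
  count-by-fibres = trans (sum-cong-≗ 𝟙≡∑-fibres) (∑-comm (λ j b → 𝟙 (fibre? b j)))

  count-≤-by-fibres : {T : Pred (Fin n) ℓ′} (T? : Decidable T) → (∀ {j} → S j → T (g j)) →
                      (∀ b → T b → count (fibre? b) ≤ m) → count S? ≤ m * count T?
  count-≤-by-fibres {m = m} {T = T} T? S⇒T fibre≤m = begin
    count S?                      ≡⟨ count-by-fibres ⟩
    ∑[ b < n ] count (fibre? b)   ≤⟨ ∑-mono-≤ fibre≤m*𝟙 ⟩
    ∑[ b < n ] (m * 𝟙 (T? b))     ≡⟨ *-distribˡ-sum m (λ b → 𝟙 (T? b)) ⟨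
    m * count T?                  ∎
    where
    open ≤-Reasoning
    fibre≤m*𝟙 : ∀ b → count (fibre? b) ≤ m * 𝟙 (T? b)
    fibre≤m*𝟙 b with T? b
    ... | yes t = ≤-trans (fibre≤m b t) (≤-reflexive (sym (*-identityʳ m)))
    ... | no ¬t = ≤-reflexive (trans (count-none (fibre? b) λ j (sⱼ , gⱼ≡b) → ¬t (subst T gⱼ≡b (S⇒T sⱼ)))
                                     (sym (*-zeroʳ m)))

∃-argmax : {P : Pred (Fin n) ℓ} → Decidable P → (h : Fin n → ℕ) → {i₀ : Fin n} → P i₀ →
           ∃ λ y → P y × (∀ i → P i → h i ≤ h y)
∃-argmax {n = n} {P = P} P? h {i₀} pᵢ₀ =
  y , P-y , λ i pᵢ → s≤s⁻¹ (subst₂ _≤_ (h′-on-P pᵢ) (h′-on-P P-y) (h′≤h′y i))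
  where
  -- Lifting h by one on P and sending the rest to 0 forces a maximiser of h′ into P.
  h′ : Fin n → ℕ
  h′ i = if does (P? i) then suc (h i) else 0
  y = argmax h′ i₀ (allFin n)
  h′≤h′y : ∀ i → h′ i ≤ h′ y
  h′≤h′y i = All.lookup (f[xs]≤f[argmax] i₀ (allFin n)) (∈-allFin i)
  h′-on-P : ∀ {i} → P i → h′ i ≡ suc (h i)
  h′-on-P {i} pᵢ with P? i
  ... | yes _ = refl
  ... | no ¬pᵢ = ⊥-elim (¬pᵢ pᵢ)
  P-y : P y
  P-y with P? y | h′≤h′y i₀
  ... | yes p | _ = p
  ... | no _ | h′i₀≤0 with () ← subst (_≤ 0) (h′-on-P pᵢ₀) h′i₀≤0

-- Cauchy–Schwarz

4*[p*q]≤[p+q]²-ordered : ∀ {p q} → p ≤ q → 4 * (p * q) ≤ (p + q) * (p + q)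
4*[p*q]≤[p+q]²-ordered {p} p≤q with m≤n⇒∃[o]m+o≡n p≤q
... | k , refl = ≤-trans (m≤m+n (4 * (p * (p + k))) (k * k)) (≤-reflexive
      (solve 2 (λ p k → con 4 :* (p :* (p :+ k)) :+ k :* k := (p :+ (p :+ k)) :* (p :+ (p :+ k))) refl p k))
  where open +-*-Solver

4*[p*q]≤[p+q]² : ∀ p q → 4 * (p * q) ≤ (p + q) * (p + q)
4*[p*q]≤[p+q]² p q with ≤-total p q
... | inj₁ p≤q = 4*[p*q]≤[p+q]²-ordered p≤q
... | inj₂ q≤p = subst₂ _≤_ (cong (4 *_) (*-comm q p)) (cong₂ _*_ (+-comm q p) (+-comm q p))
                        (4*[p*q]≤[p+q]²-ordered q≤p)

am-gm : ∀ k p q → k * k ≤ p * q → 2 * k ≤ p + q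
am-gm k p q k²≤pq with 2 * k ≤? p + q
... | yes 2k≤p+q = 2k≤p+q
... | no 2k≰p+q = ⊥-elim (<⇒≱ (*-mono-< p+q<2k p+q<2k) (begin
  (2 * k) * (2 * k)  ≡⟨ solve 1 (λ k → (con 2 :* k) :* (con 2 :* k) := con 4 :* (k :* k)) refl k ⟩
  4 * (k * k)        ≤⟨ *-monoʳ-≤ 4 k²≤pq ⟩
  4 * (p * q)        ≤⟨ 4*[p*q]≤[p+q]² p q ⟩
  (p + q) * (p + q)  ∎))
  where
  open ≤-Reasoning
  open +-*-Solver
  p+q<2k = ≰⇒> 2k≰p+q

cauchy-schwarz : ∀ {k} (a b : Fin d → ℕ) → (∀ t → k ≤ a t * b t) → d * d * k ≤ sum a * sum b
cauchy-schwarz {d} {k} a b k≤ab = *-cancelˡ-≤ 2 (begin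
  2 * (d * d * k)
    ≡⟨ solve 2 (λ d k → con 2 :* (d :* d :* k) := d :* (d :* (con 2 :* k))) refl d k ⟩
  d * (d * (2 * k))
    ≡⟨ cong (d *_) (∑-const d (2 * k)) ⟨
  d * ∑[ t < d ] (2 * k)
    ≡⟨ ∑-const d (∑[ t < d ] (2 * k)) ⟨
  ∑[ s < d ] ∑[ t < d ] (2 * k)
    ≤⟨ ∑-mono-≤ (λ s → ∑-mono-≤ λ t → am-gm k (a s * b t) (a t * b s) (k²≤ s t)) ⟩
  ∑[ s < d ] ∑[ t < d ] (a s * b t + a t * b s)
    ≡⟨ sum-cong-≗ (λ s → ∑-distrib-+ (λ t → a s * b t) (λ t → a t * b s)) ⟩
  ∑[ s < d ] (∑[ t < d ] (a s * b t) + ∑[ t < d ] (a t * b s))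
    ≡⟨ ∑-distrib-+ (λ s → ∑[ t < d ] (a s * b t)) (λ s → ∑[ t < d ] (a t * b s)) ⟩
  ∑[ s < d ] ∑[ t < d ] (a s * b t) + ∑[ s < d ] ∑[ t < d ] (a t * b s)
    ≡⟨ cong (∑[ s < d ] ∑[ t < d ] (a s * b t) +_) (∑-comm (λ s t → a t * b s)) ⟩
  ∑[ s < d ] ∑[ t < d ] (a s * b t) + ∑[ t < d ] ∑[ s < d ] (a t * b s)
    ≡⟨ cong₂ _+_ (∑-product a b) (∑-product a b) ⟩
  sum a * sum b + sum a * sum b
    ≡⟨ cong (sum a * sum b +_) (+-identityʳ _) ⟨
  2 * (sum a * sum b)
    ∎)
  where
  open ≤-Reasoning
  open +-*-Solver
  k²≤ : ∀ s t → k * k ≤ (a s * b t) * (a t * b s)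
  k²≤ s t = begin
    k * k                      ≤⟨ *-mono-≤ (k≤ab s) (k≤ab t) ⟩
    (a s * b s) * (a t * b t)  ≡⟨ solve 4 (λ p q r s → (p :* q) :* (r :* s) := (p :* s) :* (r :* q))
                                          refl (a s) (b s) (a t) (b t) ⟩
    (a s * b t) * (a t * b s)  ∎

infix 4 _≟_

_≟_ : (x y : Word d) → Dec (x ≡ y)
_≟_ = ≡-dec Bool._≟_

≡-by-lookup : {x y : Word d} → (∀ i → lookup x i ≡ lookup y i) → x ≡ y
≡-by-lookup {x = x} {y} x≗y = trans (sym (tabulate∘lookup x)) (trans (tabulate-cong x≗y) (tabulate∘lookup y))

lookup-⊕ : (x y : Word d) (i : Fin d) → lookup (x ⊕ y) i ≡ lookup x i xor lookup y i
lookup-⊕ x y i = lookup-zipWith _xor_ i x y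

⊕-assoc : (x y z : Word d) → (x ⊕ y) ⊕ z ≡ x ⊕ (y ⊕ z)
⊕-assoc = zipWith-assoc Bool.xor-assoc

⊕-comm : (x y : Word d) → x ⊕ y ≡ y ⊕ x
⊕-comm = zipWith-comm Bool.xor-comm

⊕-identityˡ : (x : Word d) → 0w ⊕ x ≡ x
⊕-identityˡ = zipWith-identityˡ Bool.xor-identityˡ

⊕-identityʳ : (x : Word d) → x ⊕ 0w ≡ x
⊕-identityʳ = zipWith-identityʳ Bool.xor-identityʳ

⊕-self : (x : Word d) → x ⊕ x ≡ 0w
⊕-self [] = refl
⊕-self (a ∷ x) = cong₂ _∷_ (Bool.xor-same a) (⊕-self x)

⊕-cancelˡ : (x y : Word d) → x ⊕ (x ⊕ y) ≡ y
⊕-cancelˡ x y = trans (sym (⊕-assoc x x y)) (trans (cong (_⊕ y) (⊕-self x)) (⊕-identityˡ y))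

⊕-cancelʳ : (x y : Word d) → (x ⊕ y) ⊕ y ≡ x
⊕-cancelʳ x y = trans (⊕-assoc x y y) (trans (cong (x ⊕_) (⊕-self y)) (⊕-identityʳ x))

⊕-solveˡ : {x y z : Word d} → x ⊕ y ≡ z → y ≡ x ⊕ z
⊕-solveˡ {x = x} {y} refl = sym (⊕-cancelˡ x y)

⊕-solveʳ : {x y z : Word d} → x ⊕ y ≡ z → x ≡ z ⊕ y
⊕-solveʳ {x = x} {y} refl = sym (⊕-cancelʳ x y)

⊕≡0w⇒≡ : {x y : Word d} → x ⊕ y ≡ 0w → x ≡ y
⊕≡0w⇒≡ {x = x} x⊕y≡0w = trans (⊕-solveʳ x⊕y≡0w) (⊕-identityˡ _)

⊕-swapʳ : (x y z : Word d) → (x ⊕ y) ⊕ z ≡ (x ⊕ z) ⊕ y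
⊕-swapʳ x y z = trans (⊕-assoc x y z) (trans (cong (x ⊕_) (⊕-comm y z)) (sym (⊕-assoc x z y)))

dot-comm : (x y : Word d) → dot x y ≡ dot y x
dot-comm [] [] = refl
dot-comm (a ∷ x) (b ∷ y) = cong₂ _xor_ (Bool.∧-comm a b) (dot-comm x y)

dot-0wʳ : (c : Word d) → dot c 0w ≡ false
dot-0wʳ [] = refl
dot-0wʳ (a ∷ c) = cong₂ _xor_ (Bool.∧-zeroʳ a) (dot-0wʳ c)

dot-⊕ʳ : (c x y : Word d) → dot c (x ⊕ y) ≡ dot c x xor dot c y
dot-⊕ʳ [] [] [] = refl
dot-⊕ʳ (a ∷ c) (b ∷ x) (b′ ∷ y) = begin
  (a ∧ (b xor b′)) xor dot c (x ⊕ y)                ≡⟨ cong₂ _xor_ (Bool.∧-distribˡ-xor a b b′) (dot-⊕ʳ c x y) ⟩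
  ((a ∧ b) xor (a ∧ b′)) xor (dot c x xor dot c y)  ≡⟨ xor-interchange (a ∧ b) (a ∧ b′) (dot c x) (dot c y) ⟩
  ((a ∧ b) xor dot c x) xor ((a ∧ b′) xor dot c y)  ∎
  where open ≡-Reasoning

e : Fin d → Word d
e fzero = true ∷ 0w
e (fsuc i) = false ∷ e i

dot-eʳ : (x : Word d) (i : Fin d) → dot x (e i) ≡ lookup x i
dot-eʳ (a ∷ x) fzero = trans (cong₂ _xor_ (Bool.∧-identityʳ a) (dot-0wʳ x)) (Bool.xor-identityʳ a)
dot-eʳ (a ∷ x) (fsuc i) = trans (cong (_xor dot x (e i)) (Bool.∧-zeroʳ a)) (dot-eʳ x i)

weight≡0⇒0w : (w : Word d) → weight w ≡ 0 → w ≡ 0w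
weight≡0⇒0w [] _ = refl
weight≡0⇒0w (false ∷ w) w≡0 = cong (false ∷_) (weight≡0⇒0w w w≡0)

weight≡suc⇒∃true : (w : Word d) {k : ℕ} → weight w ≡ suc k → ∃ λ i → lookup w i ≡ true
weight≡suc⇒∃true (true ∷ w) _ = fzero , refl
weight≡suc⇒∃true (false ∷ w) w≡suc with weight≡suc⇒∃true w w≡suc
... | i , wᵢ = fsuc i , wᵢ

weight-⊕-e : (w : Word d) (i : Fin d) → lookup w i ≡ true → weight w ≡ suc (weight (w ⊕ e i))
weight-⊕-e (true ∷ w) fzero _ = cong (suc ∘ weight) (sym (⊕-identityʳ w))
weight-⊕-e (true ∷ w) (fsuc i) wᵢ = cong suc (weight-⊕-e w i wᵢ)
weight-⊕-e (false ∷ w) (fsuc i) wᵢ = weight-⊕-e w i wᵢ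

weight-⊕-e-pred : (w : Word d) (i : Fin d) {k : ℕ} → weight w ≡ suc k → lookup w i ≡ true → weight (w ⊕ e i) ≡ k
weight-⊕-e-pred w i w≡suc wᵢ = suc-injective (trans (sym (weight-⊕-e w i wᵢ)) w≡suc)

weight≡suc⇒∃-⊕-e : (w : Word d) {k : ℕ} → weight w ≡ suc k → ∃ λ i → weight (w ⊕ e i) ≡ k
weight≡suc⇒∃-⊕-e w w≡suc with weight≡suc⇒∃true w w≡suc
... | i , wᵢ = i , weight-⊕-e-pred w i w≡suc wᵢ

weight3-decomposition : (w : Word d) (y : Fin d) → weight w ≡ 3 → lookup w y ≡ true →
                        ∃₂ λ a b → w ≡ (e a ⊕ e b) ⊕ e y
weight3-decomposition w y w≡3 wʸ with weight≡suc⇒∃-⊕-e (w ⊕ e y) (weight-⊕-e-pred w y w≡3 wʸ)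
... | b , w₂≡1 with weight≡suc⇒∃-⊕-e ((w ⊕ e y) ⊕ e b) w₂≡1
... | a , w₃≡0 = a , b , (begin
  w                                ≡⟨ ⊕-cancelʳ w (e y) ⟨
  (w ⊕ e y) ⊕ e y                  ≡⟨ cong (_⊕ e y) (⊕-cancelʳ (w ⊕ e y) (e b)) ⟨
  (((w ⊕ e y) ⊕ e b) ⊕ e b) ⊕ e y  ≡⟨ cong (λ x → (x ⊕ e b) ⊕ e y) (⊕≡0w⇒≡ (weight≡0⇒0w _ w₃≡0)) ⟩
  (e a ⊕ e b) ⊕ e y                ∎)
  where open ≡-Reasoning

∑ᵛ : (Word d → ℕ) → ℕ
∑ᵛ {zero} f = f []
∑ᵛ {suc d} f = ∑ᵛ (f ∘ (false ∷_)) + ∑ᵛ (f ∘ (true ∷_))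

∑ᵛ-cong : {f g : Word d → ℕ} → (∀ α → f α ≡ g α) → ∑ᵛ f ≡ ∑ᵛ g
∑ᵛ-cong {zero} f≗g = f≗g []
∑ᵛ-cong {suc d} f≗g = cong₂ _+_ (∑ᵛ-cong (f≗g ∘ (false ∷_))) (∑ᵛ-cong (f≗g ∘ (true ∷_)))

∑ᵛ-mono-≤ : {f g : Word d → ℕ} → (∀ α → f α ≤ g α) → ∑ᵛ f ≤ ∑ᵛ g
∑ᵛ-mono-≤ {zero} f≤g = f≤g []
∑ᵛ-mono-≤ {suc d} f≤g = +-mono-≤ (∑ᵛ-mono-≤ (f≤g ∘ (false ∷_))) (∑ᵛ-mono-≤ (f≤g ∘ (true ∷_)))

∑ᵛ-zero : ∀ d → ∑ᵛ {d} (λ _ → 0) ≡ 0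
∑ᵛ-zero zero = refl
∑ᵛ-zero (suc d) = cong₂ _+_ (∑ᵛ-zero d) (∑ᵛ-zero d)

∑ᵛ-distrib-+ : (f g : Word d → ℕ) → ∑ᵛ (λ α → f α + g α) ≡ ∑ᵛ f + ∑ᵛ g
∑ᵛ-distrib-+ {zero} f g = refl
∑ᵛ-distrib-+ {suc d} f g =
  trans (cong₂ _+_ (∑ᵛ-distrib-+ (f ∘ (false ∷_)) (g ∘ (false ∷_))) (∑ᵛ-distrib-+ (f ∘ (true ∷_)) (g ∘ (true ∷_))))
        (+-interchange (∑ᵛ (f ∘ (false ∷_))) (∑ᵛ (g ∘ (false ∷_))) (∑ᵛ (f ∘ (true ∷_))) (∑ᵛ (g ∘ (true ∷_))))

*-distribˡ-∑ᵛ : (k : ℕ) (f : Word d → ℕ) → k * ∑ᵛ f ≡ ∑ᵛ (λ α → k * f α)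
*-distribˡ-∑ᵛ {zero} k f = refl
*-distribˡ-∑ᵛ {suc d} k f =
  trans (*-distribˡ-+ k (∑ᵛ (f ∘ (false ∷_))) (∑ᵛ (f ∘ (true ∷_))))
        (cong₂ _+_ (*-distribˡ-∑ᵛ k (f ∘ (false ∷_))) (*-distribˡ-∑ᵛ k (f ∘ (true ∷_))))

∑-∑ᵛ-comm : (f : Fin n → Word d → ℕ) → ∑[ i < n ] ∑ᵛ (f i) ≡ ∑ᵛ (λ α → ∑[ i < n ] f i α)
∑-∑ᵛ-comm {zero} {d} f = sym (∑ᵛ-zero d)
∑-∑ᵛ-comm {suc n} f = trans (cong (∑ᵛ (f fzero) +_) (∑-∑ᵛ-comm (f ∘ fsuc)))
                            (sym (∑ᵛ-distrib-+ (f fzero) (λ α → ∑[ i < n ] f (fsuc i) α)))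

∑ᵛ-sift : (x : Word d) (h : Word d → ℕ) → ∑ᵛ (λ α → 𝟙 (x ≟ α) * h α) ≡ h x
∑ᵛ-sift [] h = +-identityʳ (h [])
∑ᵛ-sift {suc d} (false ∷ x) h =
  trans (cong (∑ᵛ (λ α → 𝟙 (x ≟ α) * h (false ∷ α)) +_) (∑ᵛ-zero d))
        (trans (+-identityʳ _) (∑ᵛ-sift x (h ∘ (false ∷_))))
∑ᵛ-sift {suc d} (true ∷ x) h =
  trans (cong (_+ ∑ᵛ (λ α → 𝟙 (x ≟ α) * h (true ∷ α))) (∑ᵛ-zero d)) (∑ᵛ-sift x (h ∘ (true ∷_)))

∑ᵛ-translate : (y : Word d) (f : Word d → ℕ) → ∑ᵛ (λ α → f (α ⊕ y)) ≡ ∑ᵛ f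
∑ᵛ-translate [] f = refl
∑ᵛ-translate (false ∷ y) f = cong₂ _+_ (∑ᵛ-translate y (f ∘ (false ∷_))) (∑ᵛ-translate y (f ∘ (true ∷_)))
∑ᵛ-translate (true ∷ y) f =
  trans (cong₂ _+_ (∑ᵛ-translate y (f ∘ (true ∷_))) (∑ᵛ-translate y (f ∘ (false ∷_))))
        (+-comm (∑ᵛ (f ∘ (true ∷_))) (∑ᵛ (f ∘ (false ∷_))))

-- Quotienting F₂^(d+1) by a nonzero word

-- project y eliminates the first nonzero coordinate of y; for y ≢ 0w it is a linear
-- surjection onto F₂^d with kernel {0w, y}. (For y ≡ 0w it is junk.)
project : Word (suc d) → Word (suc d) → Word d
project (true ∷ y) (false ∷ x) = x
project (true ∷ y) (true ∷ x) = x ⊕ y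
project {zero} (false ∷ []) _ = []
project {suc d} (false ∷ y) (b ∷ x) = b ∷ project y x

project-⊕ : (y x z : Word (suc d)) → project y (x ⊕ z) ≡ project y x ⊕ project y z
project-⊕ (true ∷ y) (false ∷ x) (false ∷ z) = refl
project-⊕ (true ∷ y) (false ∷ x) (true ∷ z) = ⊕-assoc x z y
project-⊕ (true ∷ y) (true ∷ x) (false ∷ z) = ⊕-swapʳ x z y
project-⊕ (true ∷ y) (true ∷ x) (true ∷ z) = begin
  x ⊕ z              ≡⟨ cong (_⊕ z) (⊕-cancelʳ x y) ⟨
  ((x ⊕ y) ⊕ y) ⊕ z  ≡⟨ ⊕-assoc (x ⊕ y) y z ⟩
  (x ⊕ y) ⊕ (y ⊕ z)  ≡⟨ cong ((x ⊕ y) ⊕_) (⊕-comm y z) ⟩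
  (x ⊕ y) ⊕ (z ⊕ y)  ∎
  where open ≡-Reasoning
project-⊕ {zero} (false ∷ []) x z = refl
project-⊕ {suc d} (false ∷ y) (a ∷ x) (b ∷ z) = cong ((a xor b) ∷_) (project-⊕ y x z)

project-0w : (y : Word (suc d)) → project y 0w ≡ 0w
project-0w (true ∷ y) = refl
project-0w {zero} (false ∷ []) = refl
project-0w {suc d} (false ∷ y) = cong (false ∷_) (project-0w y)

project-self : (y : Word (suc d)) → project y y ≡ 0w
project-self (true ∷ y) = ⊕-self y
project-self {zero} (false ∷ []) = refl
project-self {suc d} (false ∷ y) = cong (false ∷_) (project-self y)

project-kernel : (y x : Word (suc d)) → y ≢ 0w → project y x ≡ 0w → x ≡ 0w ⊎ x ≡ y
project-kernel (true ∷ y) (false ∷ x) _ x≡0w = inj₁ (cong (false ∷_) x≡0w)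
project-kernel (true ∷ y) (true ∷ x) _ x⊕y≡0w = inj₂ (cong (true ∷_) (⊕≡0w⇒≡ x⊕y≡0w))
project-kernel {zero} (false ∷ []) x y≢0w _ = ⊥-elim (y≢0w refl)
project-kernel {suc d} (false ∷ y) (false ∷ x) y≢0w φx≡0w =
  Sum.map (cong (false ∷_)) (cong (false ∷_)) (project-kernel y x (y≢0w ∘ cong (false ∷_)) (∷-injectiveʳ φx≡0w))

project-≡ : (y x z : Word (suc d)) → y ≢ 0w → project y x ≡ project y z → z ≡ x ⊎ z ≡ x ⊕ y
project-≡ y x z y≢0w φx≡φz =
  Sum.map (sym ∘ ⊕≡0w⇒≡) ⊕-solveˡ (project-kernel y (x ⊕ z) y≢0w (begin
    project y (x ⊕ z)          ≡⟨ project-⊕ y x z ⟩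
    project y x ⊕ project y z  ≡⟨ cong (_⊕ project y z) φx≡φz ⟩
    project y z ⊕ project y z  ≡⟨ ⊕-self (project y z) ⟩
    0w                         ∎))
  where open ≡-Reasoning

∑ᵛ-project : (y : Word (suc d)) → y ≢ 0w → (f : Word d → ℕ) → ∑ᵛ (f ∘ project y) ≡ ∑ᵛ f + ∑ᵛ f
∑ᵛ-project (true ∷ y) _ f = cong (∑ᵛ f +_) (∑ᵛ-translate y f)
∑ᵛ-project {zero} (false ∷ []) y≢0w f = ⊥-elim (y≢0w refl)
∑ᵛ-project {suc d} (false ∷ y) y≢0w f =
  trans (cong₂ _+_ (∑ᵛ-project y y≢0w′ (f ∘ (false ∷_))) (∑ᵛ-project y y≢0w′ (f ∘ (true ∷_))))
        (+-interchange (∑ᵛ (f ∘ (false ∷_))) _ (∑ᵛ (f ∘ (true ∷_))) _)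
  where
  y≢0w′ : y ≢ 0w
  y≢0w′ = y≢0w ∘ cong (false ∷_)

lift : Word (suc d) → Word d → Word (suc d)
lift (true ∷ y) c = dot c y ∷ c
lift {zero} (false ∷ []) [] = 0w
lift {suc d} (false ∷ y) (c₀ ∷ c) = c₀ ∷ lift y c

dot-lift : (y x : Word (suc d)) (c : Word d) → dot (lift y c) x ≡ dot c (project y x)
dot-lift (true ∷ y) (false ∷ x) c = cong (_xor dot c x) (Bool.∧-zeroʳ (dot c y))
dot-lift (true ∷ y) (true ∷ x) c = begin
  (dot c y ∧ true) xor dot c x  ≡⟨ cong (_xor dot c x) (Bool.∧-identityʳ (dot c y)) ⟩
  dot c y xor dot c x           ≡⟨ Bool.xor-comm (dot c y) (dot c x) ⟩
  dot c x xor dot c y           ≡⟨ dot-⊕ʳ c x y ⟨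
  dot c (x ⊕ y)                 ∎
  where open ≡-Reasoning
dot-lift {zero} (false ∷ []) (b ∷ []) [] = refl
dot-lift {suc d} (false ∷ y) (b ∷ x) (c₀ ∷ c) = cong ((c₀ ∧ b) xor_) (dot-lift y x c)

lift-injective : (y : Word (suc d)) (c : Word d) → lift y c ≡ 0w → c ≡ 0w
lift-injective (true ∷ y) c lift≡0w = ∷-injectiveʳ lift≡0w
lift-injective {zero} (false ∷ []) [] _ = refl
lift-injective {suc d} (false ∷ y) (c₀ ∷ c) lift≡0w =
  cong₂ _∷_ (∷-injectiveˡ lift≡0w) (lift-injective y c (∷-injectiveʳ lift≡0w))

Spanning : (Fin n → Word d) → Set
Spanning u = ∀ c → (∀ i → dot c (u i) ≡ false) → c ≡ 0w

Spanning-project : (y : Word (suc d)) {u : Fin n → Word (suc d)} → Spanning u → Spanning (project y ∘ u)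
Spanning-project y {u} span c c⊥ = lift-injective y c (span (lift y c) λ i → trans (dot-lift y (u i) c) (c⊥ i))

Spanning⇒∃≢0w : {u : Fin n → Word (suc d)} → Spanning u → ∃ λ i → u i ≢ 0w
Spanning⇒∃≢0w {n = n} {d = d} {u = u} span = Fin.¬∀⟶∃¬ n (λ i → u i ≡ 0w) (λ i → u i ≟ 0w) ¬all-zero
  where
  ¬all-zero : ¬ (∀ i → u i ≡ 0w)
  ¬all-zero u≡0w with span (e fzero) (λ i → trans (cong (dot (e fzero)) (u≡0w i)) (dot-0wʳ (e {suc d} fzero)))
  ... | ()

Attained : (Fin n → Word d) → Pred (Word d) 0ℓ
Attained u α = ∃ λ i → u i ≡ α

attained? : (u : Fin n → Word d) → Decidable (Attained u)
attained? u α = Fin.any? (λ i → u i ≟ α)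

NonzeroValue : (Fin n → Word d) → Pred (Word d) 0ℓ
NonzeroValue u α = α ≢ 0w × Attained u α

nonzeroValue? : (u : Fin n → Word d) → Decidable (NonzeroValue u)
nonzeroValue? u α = ¬? (α ≟ 0w) ×-dec attained? u α

Paired : (Fin n → Word d) → Word d → Pred (Word d) 0ℓ
Paired u y α = NonzeroValue u α × Attained u (α ⊕ y)

paired? : (u : Fin n → Word d) (y : Word d) → Decidable (Paired u y)
paired? u y α = nonzeroValue? u α ×-dec attained? u (α ⊕ y)

classSize : (Fin n → Word d) → Word d → ℕ
classSize u α = count (λ i → u i ≟ α)

live : (Fin n → Word d) → ℕ
live u = count (λ i → ¬? (u i ≟ 0w))

live≤n : (u : Fin n → Word d) → live u ≤ n
live≤n u = count≤n (λ i → ¬? (u i ≟ 0w))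

values : (Fin n → Word d) → ℕ
values u = ∑ᵛ (λ α → 𝟙 (nonzeroValue? u α))

pairs : (Fin n → Word d) → Word d → ℕ
pairs u y = ∑ᵛ (λ α → 𝟙 (paired? u y α))

pairedPoints : (Fin n → Word d) → Word d → ℕ
pairedPoints u y = count (λ i → paired? u y (u i))

∑-pushforward : (u : Fin n → Word d) (h : Word d → ℕ) → ∑[ i < n ] h (u i) ≡ ∑ᵛ (λ α → classSize u α * h α)
∑-pushforward {n = n} u h = begin
  ∑[ i < n ] h (u i)                         ≡⟨ sum-cong-≗ (λ i → ∑ᵛ-sift (u i) h) ⟨
  ∑[ i < n ] ∑ᵛ (λ α → 𝟙 (u i ≟ α) * h α)    ≡⟨ ∑-∑ᵛ-comm (λ i α → 𝟙 (u i ≟ α) * h α) ⟩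
  ∑ᵛ (λ α → ∑[ i < n ] (𝟙 (u i ≟ α) * h α))  ≡⟨ ∑ᵛ-cong (λ α → *-distribʳ-sum (h α) (𝟙 ∘ (_≟ α) ∘ u)) ⟨
  ∑ᵛ (λ α → classSize u α * h α)             ∎
  where open ≡-Reasoning

m*values≤n : (u : Fin n → Word d) → (∀ α → Attained u α → m ≤ classSize u α) → m * values u ≤ n
m*values≤n {n = n} {m = m} u large = begin
  m * values u                          ≡⟨ *-distribˡ-∑ᵛ m (𝟙 ∘ nonzeroValue? u) ⟩
  ∑ᵛ (λ α → m * 𝟙 (nonzeroValue? u α))  ≤⟨ ∑ᵛ-mono-≤ m*𝟙≤classSize ⟩
  ∑ᵛ (λ α → classSize u α * 1)          ≡⟨ ∑-pushforward u (λ _ → 1) ⟨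
  ∑[ i < n ] 1                          ≡⟨ trans (∑-const n 1) (*-identityʳ n) ⟩
  n                                     ∎
  where
  open ≤-Reasoning
  m*𝟙≤classSize : ∀ α → m * 𝟙 (nonzeroValue? u α) ≤ classSize u α * 1
  m*𝟙≤classSize α = *-𝟙-≤ (nonzeroValue? u α) λ (_ , attained) →
    ≤-trans (large α attained) (≤-reflexive (sym (*-identityʳ _)))

pairedPoints≤F*pairs : (u : Fin n → Word d) (y : Word d) {F : ℕ} →
                       (∀ i → u i ≢ 0w → classSize u (u i) ≤ F) → pairedPoints u y ≤ F * pairs u y
pairedPoints≤F*pairs u y {F} classSize≤F = begin
  pairedPoints u y                              ≡⟨ ∑-pushforward u (𝟙 ∘ paired? u y) ⟩
  ∑ᵛ (λ α → classSize u α * 𝟙 (paired? u y α))  ≤⟨ ∑ᵛ-mono-≤ (λ α → *-𝟙-monoˡ-≤ (paired? u y α) (paired⇒≤F α)) ⟩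
  ∑ᵛ (λ α → F * 𝟙 (paired? u y α))              ≡⟨ *-distribˡ-∑ᵛ F (𝟙 ∘ paired? u y) ⟨
  F * pairs u y                                 ∎
  where
  open ≤-Reasoning
  paired⇒≤F : ∀ α → Paired u y α → classSize u α ≤ F
  paired⇒≤F _ ((uᵢ≢0w , i , refl) , _) = classSize≤F i uᵢ≢0w

live-project : (y : Word (suc d)) → y ≢ 0w → (u : Fin n → Word (suc d)) →
               live u ≡ live (project y ∘ u) + classSize u y
live-project {n = n} y y≢0w u = begin
  live u
    ≡⟨ sum-cong-≗ (λ i → 𝟙-split (u i)) ⟩
  ∑[ i < n ] (𝟙 (¬? (project y (u i) ≟ 0w)) + 𝟙 (u i ≟ y))
    ≡⟨ ∑-distrib-+ (λ i → 𝟙 (¬? (project y (u i) ≟ 0w))) (λ i → 𝟙 (u i ≟ y)) ⟩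
  live (project y ∘ u) + classSize u y
    ∎
  where
  open ≡-Reasoning
  𝟙-split : ∀ x → 𝟙 (¬? (x ≟ 0w)) ≡ 𝟙 (¬? (project y x ≟ 0w)) + 𝟙 (x ≟ y)
  𝟙-split x with x ≟ y
  ... | yes refl = trans (𝟙-yes (¬? (y ≟ 0w)) y≢0w)
                         (cong (_+ 1) (sym (𝟙-no (¬? (project y y ≟ 0w)) (λ φy≢0w → φy≢0w (project-self y)))))
  ... | no x≢y = trans (𝟙-cong (¬? (x ≟ 0w)) (¬? (project y x ≟ 0w)) x≢0w⇒φx≢0w φx≢0w⇒x≢0w)
                       (sym (+-identityʳ _))
    where
    x≢0w⇒φx≢0w : x ≢ 0w → project y x ≢ 0w
    x≢0w⇒φx≢0w x≢0w φx≡0w = [ x≢0w , x≢y ] (project-kernel y x y≢0w φx≡0w)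
    φx≢0w⇒x≢0w : project y x ≢ 0w → x ≢ 0w
    φx≢0w⇒x≢0w φx≢0w refl = φx≢0w (project-0w y)

values-project : (y : Word (suc d)) → y ≢ 0w → (u : Fin n → Word (suc d)) →
                 pairs u y + (values (project y ∘ u) + values (project y ∘ u)) ≤ values u + values u
values-project y y≢0w u = begin
  pairs u y + (values u′ + values u′)
    ≡⟨ cong (pairs u y +_) (∑ᵛ-project y y≢0w (𝟙 ∘ nonzeroValue? u′)) ⟨
  pairs u y + ∑ᵛ (λ z → 𝟙 (nonzeroValue? u′ (project y z)))
    ≡⟨ ∑ᵛ-distrib-+ (𝟙 ∘ paired? u y) (𝟙 ∘ nonzeroValue? u′ ∘ project y) ⟨
  ∑ᵛ (λ z → 𝟙 (paired? u y z) + 𝟙 (nonzeroValue? u′ (project y z)))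
    ≤⟨ ∑ᵛ-mono-≤ pointwise ⟩
  ∑ᵛ (λ z → 𝟙 (nonzeroValue? u z) + 𝟙 (nonzeroValue? u (z ⊕ y)))
    ≡⟨ ∑ᵛ-distrib-+ (𝟙 ∘ nonzeroValue? u) (λ z → 𝟙 (nonzeroValue? u (z ⊕ y))) ⟩
  values u + ∑ᵛ (λ z → 𝟙 (nonzeroValue? u (z ⊕ y)))
    ≡⟨ cong (values u +_) (∑ᵛ-translate y (𝟙 ∘ nonzeroValue? u)) ⟩
  values u + values u
    ∎
  where
  open ≤-Reasoning
  u′ = project y ∘ u
  φz≢0w⇒ : ∀ {z} → project y z ≢ 0w → z ≢ 0w × z ⊕ y ≢ 0w
  φz≢0w⇒ φz≢0w = (λ { refl → φz≢0w (project-0w y) })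
               , (λ z⊕y≡0w → φz≢0w (trans (cong (project y) (⊕≡0w⇒≡ z⊕y≡0w)) (project-self y)))
  value-lifts : ∀ z → NonzeroValue u′ (project y z) → NonzeroValue u z ⊎ NonzeroValue u (z ⊕ y)
  value-lifts z (φz≢0w , i , φuᵢ≡φz) with project-≡ y (u i) z y≢0w φuᵢ≡φz
  ... | inj₁ refl = inj₁ (proj₁ (φz≢0w⇒ φz≢0w) , i , refl)
  ... | inj₂ refl = inj₂ (proj₂ (φz≢0w⇒ φz≢0w) , i , sym (⊕-cancelʳ (u i) y))
  pointwise : ∀ z → 𝟙 (paired? u y z) + 𝟙 (nonzeroValue? u′ (project y z))
                    ≤ 𝟙 (nonzeroValue? u z) + 𝟙 (nonzeroValue? u (z ⊕ y))
  pointwise z =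
    𝟙-+-≤ (paired? u y z) (nonzeroValue? u′ (project y z)) (nonzeroValue? u z) (nonzeroValue? u (z ⊕ y))
          proj₁ (value-lifts z) λ (_ , z⊕y-attained) (φz≢0w , _) → proj₂ (φz≢0w⇒ φz≢0w) , z⊕y-attained

-- The greedy quotient argument

-- A y j and B y j are the two other points of the j-th triangle through y; the fibre bound is
-- all that regularity contributes here.
module TriangleSystem {n σ m : ℕ} (A B : Fin n → Fin σ → Fin n)
  (incident≤m : ∀ y b → count (λ j → (A y j Fin.≟ b) ⊎-dec (B y j Fin.≟ b)) ≤ m) where

  Triangles : (Fin n → Word d) → Set
  Triangles u = ∀ y j → u (A y j) ⊕ u (B y j) ≡ u y

  Triangles-project : (y : Word (suc d)) {u : Fin n → Word (suc d)} → Triangles u → Triangles (project y ∘ u)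
  Triangles-project y {u} tri y′ j = trans (sym (project-⊕ y (u (A y′ j)) (u (B y′ j)))) (cong (project y) (tri y′ j))

  σ≤m*pairedPoints : {u : Fin n → Word d} → Triangles u → (y : Fin n) → u y ≢ 0w → σ ≤ m * pairedPoints u (u y)
  σ≤m*pairedPoints {u = u} tri y uʸ≢0w = begin
    σ                          ≡⟨ count-all (U? {A = Fin σ}) (λ _ → tt) ⟨
    count (U? {A = Fin σ})     ≤⟨ count-≤-by-fibres U? vertex (paired? u (u y) ∘ u) (λ {j} _ → proj₂ (proj₂ (reach j)))
                                                    fibre≤m ⟩
    m * pairedPoints u (u y)   ∎
    where
    open ≤-Reasoning
    reach : ∀ j → Σ (Fin n) λ b → (A y j ≡ b ⊎ B y j ≡ b) × Paired u (u y) (u b)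
    reach j with u (B y j) ≟ 0w
    ... | no uᴮ≢0w = B y j , inj₂ refl , (uᴮ≢0w , B y j , refl) , A y j , uᴬ≡uᴮ⊕uʸ
      where
      uᴬ≡uᴮ⊕uʸ : u (A y j) ≡ u (B y j) ⊕ u y
      uᴬ≡uᴮ⊕uʸ = trans (⊕-solveʳ (tri y j)) (⊕-comm (u y) (u (B y j)))
    ... | yes uᴮ≡0w = A y j , inj₁ refl , (uᴬ≢0w , A y j , refl) , B y j , ⊕-solveˡ (tri y j)
      where
      uᴬ≢0w : u (A y j) ≢ 0w
      uᴬ≢0w uᴬ≡0w = uʸ≢0w (trans (sym (tri y j)) (trans (cong₂ _⊕_ uᴬ≡0w uᴮ≡0w) (⊕-self 0w)))
    vertex : Fin σ → Fin n
    vertex = proj₁ ∘ reach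
    fibre≤m : ∀ b → Paired u (u y) (u b) → count (fibre? U? vertex b) ≤ m
    fibre≤m b _ = ≤-trans (count-mono (fibre? U? vertex b) (λ j → (A y j Fin.≟ b) ⊎-dec (B y j Fin.≟ b)) incident)
                          (incident≤m y b)
      where
      incident : ∀ {j} → U j × vertex j ≡ b → A y j ≡ b ⊎ B y j ≡ b
      incident {j} (_ , refl) = proj₁ (proj₂ (reach j))

  record Profile (d : ℕ) (u : Fin n → Word d) : Set where
    field
      a b : Fin d → ℕ
      σ≤a*b : ∀ t → σ ≤ a t * b t
      ∑a≤live : sum a ≤ live u
      ∑b≤values : sum b ≤ m * (values u + values u)

  greedy : ∀ d (u : Fin n → Word d) → Spanning u → Triangles u → Profile d u
  greedy zero u _ _ = record { a = λ () ; b = λ () ; σ≤a*b = λ () ; ∑a≤live = z≤n ; ∑b≤values = z≤n }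
  greedy (suc d) u span tri
    with ∃-argmax (λ i → ¬? (u i ≟ 0w)) (λ i → classSize u (u i)) (proj₂ (Spanning⇒∃≢0w span))
  ... | y , Y≢0w , maximal = record
    { a = F Vector.∷ a
    ; b = m * pairs u Y Vector.∷ b
    ; σ≤a*b = λ { fzero → σ≤F*[m*pairs] ; (fsuc t) → σ≤a*b t }
    ; ∑a≤live = begin
        F + sum a                  ≤⟨ +-monoʳ-≤ F ∑a≤live ⟩
        F + live u′                ≡⟨ +-comm F (live u′) ⟩
        live u′ + F                ≡⟨ live-project Y Y≢0w u ⟨
        live u                     ∎
    ; ∑b≤values = begin
        m * pairs u Y + sum b                         ≤⟨ +-monoʳ-≤ (m * pairs u Y) ∑b≤values ⟩
        m * pairs u Y + m * (values u′ + values u′)   ≡⟨ *-distribˡ-+ m (pairs u Y) _ ⟨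
        m * (pairs u Y + (values u′ + values u′))     ≤⟨ *-monoʳ-≤ m (values-project Y Y≢0w u) ⟩
        m * (values u + values u)                     ∎
    }
    where
    open ≤-Reasoning
    open +-*-Solver
    Y = u y
    F = classSize u Y
    u′ = project Y ∘ u
    open Profile (greedy d u′ (Spanning-project Y span) (Triangles-project Y tri))
    σ≤F*[m*pairs] : σ ≤ F * (m * pairs u Y)
    σ≤F*[m*pairs] = begin
      σ                      ≤⟨ σ≤m*pairedPoints tri y Y≢0w ⟩
      m * pairedPoints u Y   ≤⟨ *-monoʳ-≤ m (pairedPoints≤F*pairs u Y maximal) ⟩
      m * (F * pairs u Y)    ≡⟨ solve 3 (λ m F p → m :* (F :* p) := F :* (m :* p)) refl m F (pairs u Y) ⟩
      F * (m * pairs u Y)    ∎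

-- Linear codes

lookup-lincomb : ∀ {k n} (c : Fin k → Bool) (v : Fin k → Word n) (i : Fin n) →
                 lookup (lincomb c v) i ≡ dot (tabulate c) (column v i)
lookup-lincomb {zero} c v i = lookup-replicate i false
lookup-lincomb {suc k} c v i = begin
  lookup ((c fzero ·s v fzero) ⊕ lincomb (c ∘ fsuc) (v ∘ fsuc)) i
    ≡⟨ lookup-⊕ (c fzero ·s v fzero) _ i ⟩
  lookup (c fzero ·s v fzero) i xor lookup (lincomb (c ∘ fsuc) (v ∘ fsuc)) i
    ≡⟨ cong₂ _xor_ (lookup-map i (c fzero ∧_) (v fzero)) (lookup-lincomb (c ∘ fsuc) (v ∘ fsuc) i) ⟩
  (c fzero ∧ lookup (v fzero) i) xor dot (tabulate (c ∘ fsuc)) (column (v ∘ fsuc) i)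
    ∎
  where open ≡-Reasoning

row-InCode : ∀ {k n} (G : Fin k → Word n) (r : Fin k) → InCode G (G r)
row-InCode G r = lookup (e r) , ≡-by-lookup λ i → begin
  lookup (lincomb (lookup (e r)) G) i         ≡⟨ lookup-lincomb (lookup (e r)) G i ⟩
  dot (tabulate (lookup (e r))) (column G i)  ≡⟨ cong (λ x → dot x (column G i)) (tabulate∘lookup (e r)) ⟩
  dot (e r) (column G i)                      ≡⟨ dot-comm (e r) (column G i) ⟩
  dot (column G i) (e r)                      ≡⟨ dot-eʳ (column G i) r ⟩
  lookup (column G i) r                       ≡⟨ lookup∘tabulate _ r ⟩
  lookup (G r) i                              ∎
  where open ≡-Reasoning

InCode-lookup-cong : ∀ {k n} (G : Fin k → Word n) {x : Word n} {i j : Fin n} →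
                     InCode G x → column G i ≡ column G j → lookup x i ≡ lookup x j
InCode-lookup-cong G {i = i} {j} (c , refl) colᵢ≡colⱼ = begin
  lookup (lincomb c G) i         ≡⟨ lookup-lincomb c G i ⟩
  dot (tabulate c) (column G i)  ≡⟨ cong (dot (tabulate c)) colᵢ≡colⱼ ⟩
  dot (tabulate c) (column G j)  ≡⟨ lookup-lincomb c G j ⟨
  lookup (lincomb c G) j         ∎
  where open ≡-Reasoning

column-cong : ∀ {k k′ n} (G : Fin k → Word n) (v : Fin k′ → Word n) {i j : Fin n} →
              (∀ s → InCode G (v s)) → column G i ≡ column G j → column v i ≡ column v j
column-cong G v vᶜ colᵢ≡colⱼ = tabulate-cong λ s → InCode-lookup-cong G (vᶜ s) colᵢ≡colⱼ

LinIndep⇒Spanning : ∀ {n} (v : Fin d → Word n) → LinIndep v → Spanning (column v)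
LinIndep⇒Spanning v indep c c⊥ = ≡-by-lookup λ r →
  trans (indep (lookup c) lincomb≡0w r) (sym (lookup-replicate r false))
  where
  lincomb≡0w : lincomb (lookup c) v ≡ 0w
  lincomb≡0w = ≡-by-lookup λ i → begin
    lookup (lincomb (lookup c) v) i         ≡⟨ lookup-lincomb (lookup c) v i ⟩
    dot (tabulate (lookup c)) (column v i)  ≡⟨ cong (λ x → dot x (column v i)) (tabulate∘lookup c) ⟩
    dot c (column v i)                      ≡⟨ c⊥ i ⟩
    false                                   ≡⟨ lookup-replicate i false ⟨
    lookup 0w i                             ∎
    where open ≡-Reasoning

colSum : ∀ {k n} → (Fin k → Word n) → Word n → Word k
colSum v x = tabulate (λ s → dot (v s) x)

colSum-e : ∀ {k n} (v : Fin k → Word n) (i : Fin n) → colSum v (e i) ≡ column v i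
colSum-e v i = tabulate-cong (λ s → dot-eʳ (v s) i)

colSum-⊕ : ∀ {k n} (v : Fin k → Word n) (x y : Word n) → colSum v (x ⊕ y) ≡ colSum v x ⊕ colSum v y
colSum-⊕ v x y = ≡-by-lookup λ s → begin
  lookup (colSum v (x ⊕ y)) s                      ≡⟨ lookup∘tabulate _ s ⟩
  dot (v s) (x ⊕ y)                                ≡⟨ dot-⊕ʳ (v s) x y ⟩
  dot (v s) x xor dot (v s) y                      ≡⟨ cong₂ _xor_ (lookup∘tabulate _ s) (lookup∘tabulate _ s) ⟨
  lookup (colSum v x) s xor lookup (colSum v y) s  ≡⟨ lookup-⊕ (colSum v x) (colSum v y) s ⟨
  lookup (colSum v x ⊕ colSum v y) s               ∎
  where open ≡-Reasoning

colSum-InDual : ∀ {k k′ n} (G : Fin k → Word n) (v : Fin k′ → Word n) {w : Word n} →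
                (∀ s → InCode G (v s)) → InDual G w → colSum v w ≡ 0w
colSum-InDual G v vᶜ w⊥ = ≡-by-lookup λ s →
  trans (lookup∘tabulate _ s) (trans (w⊥ (v s) (vᶜ s)) (sym (lookup-replicate s false)))

column-triangle : ∀ {k k′ n} (G : Fin k → Word n) (v : Fin k′ → Word n) {w : Word n} {a b y : Fin n} →
                  (∀ s → InCode G (v s)) → InDual G w → w ≡ (e a ⊕ e b) ⊕ e y →
                  column v a ⊕ column v b ≡ column v y
column-triangle G v {a = a} {b} {y} vᶜ w⊥ refl = ⊕≡0w⇒≡ (begin
  (column v a ⊕ column v b) ⊕ column v y          ≡⟨ cong₂ (λ p q → (p ⊕ q) ⊕ column v y) (colSum-e v a) (colSum-e v b) ⟨
  (colSum v (e a) ⊕ colSum v (e b)) ⊕ column v y  ≡⟨ cong₂ _⊕_ (colSum-⊕ v (e a) (e b)) (colSum-e v y) ⟨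
  colSum v (e a ⊕ e b) ⊕ colSum v (e y)           ≡⟨ colSum-⊕ v (e a ⊕ e b) (e y) ⟨
  colSum v ((e a ⊕ e b) ⊕ e y)                    ≡⟨ colSum-InDual G v vᶜ w⊥ ⟩
  0w                                              ∎)
  where open ≡-Reasoning

length-filterᵇ-tabulate : {X : Set ℓ′} {P : Pred X ℓ} (P? : Decidable P) (f : Fin n → X) →
                          length (filterᵇ (isYes ∘ P?) (List.tabulate f)) ≡ count (P? ∘ f)
length-filterᵇ-tabulate {n = zero} P? f = refl
length-filterᵇ-tabulate {n = suc n} P? f with P? (f fzero)
... | yes _ = cong suc (length-filterᵇ-tabulate P? (f ∘ fsuc))
... | no _ = length-filterᵇ-tabulate P? (f ∘ fsuc)

multiplicity≡count : ∀ {k n} (G : Fin k → Word n) (j : Fin n) →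
                     multiplicity G j ≡ count (λ j′ → column G j′ ≟ column G j)
multiplicity≡count G j = length-filterᵇ-tabulate (λ j′ → column G j′ ≟ column G j) (λ j′ → j′)

Regular⇒constant : ∀ {k n} (G : Fin k → Word n) → Regular G → ∃ λ m → ∀ j → multiplicity G j ≡ m
Regular⇒constant {n = zero} G _ = 0 , λ ()
Regular⇒constant {n = suc n} G regular = multiplicity G fzero , λ j → regular j fzero

module _ {k n m : ℕ} (G : Fin k → Word n) (multiplicity≡m : ∀ j → multiplicity G j ≡ m) where

  count-column≤m : ∀ z → count (λ i → column G i ≟ z) ≤ m
  count-column≤m z with Fin.any? (λ i → column G i ≟ z)
  ... | yes (i , refl) = ≤-reflexive (trans (sym (multiplicity≡count G i)) (multiplicity≡m i))
  ... | no ¬attained =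
    ≤-trans (≤-reflexive (count-none (λ i → column G i ≟ z) (λ i colᵢ≡z → ¬attained (i , colᵢ≡z)))) z≤n

  m≤classSize : (v : Fin d → Word n) → (∀ s → InCode G (v s)) →
                ∀ α → Attained (column v) α → m ≤ classSize (column v) α
  m≤classSize v vᶜ _ (i , refl) = begin
    m                                      ≡⟨ multiplicity≡m i ⟨
    multiplicity G i                       ≡⟨ multiplicity≡count G i ⟩
    count (λ j → column G j ≟ column G i)  ≤⟨ count-mono (λ j → column G j ≟ column G i) (λ j → column v j ≟ column v i)
                                                         (column-cong G v vᶜ) ⟩
    classSize (column v) (column v i)      ∎
    where open ≤-Reasoning

module DualTriangles {k n σ : ℕ} (G : Fin k → Word n)
  (H : ∀ (i : Fin n) → Σ (Fin σ → Word n) λ f → Injective _≡_ _≡_ f ×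
         (∀ j → InDual G (f j) × weight (f j) ≡ 3 × lookup (f j) i ≡ true)) where

  W : Fin n → Fin σ → Word n
  W y = proj₁ (H y)

  W-InDual : ∀ y j → InDual G (W y j)
  W-InDual y j = proj₁ (proj₂ (proj₂ (H y)) j)

  W-decomposition : ∀ y j → ∃₂ λ a b → W y j ≡ (e a ⊕ e b) ⊕ e y
  W-decomposition y j = weight3-decomposition (W y j) y (proj₁ (proj₂ W-props)) (proj₂ (proj₂ W-props))
    where W-props = proj₂ (proj₂ (H y)) j

  A B : Fin n → Fin σ → Fin n
  A y j = proj₁ (W-decomposition y j)
  B y j = proj₁ (proj₂ (W-decomposition y j))

  W≡triangle : ∀ y j → W y j ≡ (e (A y j) ⊕ e (B y j)) ⊕ e y
  W≡triangle y j = proj₂ (proj₂ (W-decomposition y j))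

  column-triangles : (v : Fin d → Word n) → (∀ s → InCode G (v s)) →
                     ∀ y j → column v (A y j) ⊕ column v (B y j) ≡ column v y
  column-triangles v vᶜ y j = column-triangle G v vᶜ (W-InDual y j) (W≡triangle y j)

  -- The third point t of a triangle through y and b fixes the dual word, which is then
  -- e b ⊕ e t ⊕ e y; and its column is column G b ⊕ column G y, shared by at most m points.
  incident≤m : ∀ {m} → (∀ j → multiplicity G j ≡ m) →
               ∀ y b → count (λ j → (A y j Fin.≟ b) ⊎-dec (B y j Fin.≟ b)) ≤ m
  incident≤m {m} multiplicity≡m y b = begin
    count incident?    ≤⟨ count-≤-by-fibres incident? third target? third-target
                                            (λ t _ → count-≤1 (fibre? incident? third t) third-injective) ⟩
    1 * count target?  ≡⟨ *-identityˡ _ ⟩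
    count target?      ≤⟨ count-column≤m G multiplicity≡m (column G b ⊕ column G y) ⟩
    m                  ∎
    where
    open ≤-Reasoning
    incident? = λ j → (A y j Fin.≟ b) ⊎-dec (B y j Fin.≟ b)
    target? = λ i → column G i ≟ column G b ⊕ column G y
    third : Fin σ → Fin n
    third j with A y j Fin.≟ b
    ... | yes _ = B y j
    ... | no _ = A y j
    W≡third : ∀ {j} → A y j ≡ b ⊎ B y j ≡ b → W y j ≡ (e b ⊕ e (third j)) ⊕ e y
    W≡third {j} incident with A y j Fin.≟ b | incident
    ... | yes refl | _ = W≡triangle y j
    ... | no Aʸʲ≢b | inj₁ Aʸʲ≡b = ⊥-elim (Aʸʲ≢b Aʸʲ≡b)
    ... | no _ | inj₂ refl = trans (W≡triangle y j) (cong (_⊕ e y) (⊕-comm (e (A y j)) (e b)))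
    third-target : ∀ {j} → A y j ≡ b ⊎ B y j ≡ b → column G (third j) ≡ column G b ⊕ column G y
    third-target incident = ⊕-solveˡ (column-triangle G G (row-InCode G) (W-InDual y _) (W≡third incident))
    third-injective : ∀ {t j j′} → (A y j ≡ b ⊎ B y j ≡ b) × third j ≡ t →
                      (A y j′ ≡ b ⊎ B y j′ ≡ b) × third j′ ≡ t → j ≡ j′
    third-injective (incident , refl) (incident′ , third≡) = proj₁ (proj₂ (H y))
      (trans (W≡third incident) (trans (cong (λ t → (e b ⊕ e t) ⊕ e y) (sym third≡)) (sym (W≡third incident′))))

theorem1p5 : ∀ {k n : ℕ} (G : Fin k → Word n) (σ : ℕ) → 1 ≤ σ → Regular G →
    (∀ (i : Fin n) → Σ (Fin σ → Word n) λ f → Injective _≡_ _≡_ f ×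
    (∀ j → InDual G (f j) × weight (f j) ≡ 3 × lookup (f j) i ≡ true)) →
    ∀ (d : ℕ) (v : Fin d → Word n) → (∀ r → InCode G (v r)) → LinIndep v →
    d * d * σ ≤ 4 * n * n
theorem1p5 {n = n} G σ _ regular H d v vᶜ indep = begin
  d * d * σ                  ≤⟨ cauchy-schwarz a b σ≤a*b ⟩
  sum a * sum b              ≤⟨ *-mono-≤ (≤-trans ∑a≤live (live≤n (column v))) (≤-trans ∑b≤values μ*values≤n+n) ⟩
  n * (n + n)                ≤⟨ m≤m+n (n * (n + n)) (n * (n + n)) ⟩
  n * (n + n) + n * (n + n)  ≡⟨ solve 1 (λ n → n :* (n :+ n) :+ n :* (n :+ n) := con 4 :* n :* n) refl n ⟩
  4 * n * n                  ∎
  where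
  open ≤-Reasoning
  open +-*-Solver
  μ = proj₁ (Regular⇒constant G regular)
  multiplicity≡μ = proj₂ (Regular⇒constant G regular)
  open DualTriangles G H
  open TriangleSystem A B (incident≤m multiplicity≡μ)
  open Profile (greedy d (column v) (LinIndep⇒Spanning v indep) (column-triangles v vᶜ))
  μ*values≤n : μ * values (column v) ≤ n
  μ*values≤n = m*values≤n (column v) (m≤classSize G multiplicity≡μ v vᶜ)
  μ*values≤n+n : μ * (values (column v) + values (column v)) ≤ n + n
  μ*values≤n+n = ≤-trans (≤-reflexive (*-distribˡ-+ μ _ _)) (+-mono-≤ μ*values≤n μ*values≤n)
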